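{- For $n\ge1$ and all $k\ge 0$, $S(n,k)=T(n,2k)+T(n,2k+1)$ and $P(n,k)=T(n,2k+1)+T(n,2k+2)$; equivalently, $(1+x)T_n(x)=xS_n(x^2)+x^2P_n(x^2)$.
   Context: A permutation $\pi\in\mathfrak{S}_n$ is called simsun if for every $k$, the subword of $\pi$ consisting of the letters in $[k]$ (in the order they appear) contains no three consecutive entries $a>b>c$. Let $\mathcal{RS}_n$ be the set of simsun permutations of $[n]$. Let ${\rm des}(\pi)=\#\{i\in[n-1]:\pi(i)>\pi(i+1)\}$, $S(n,k)=\#\{\pi\in\mathcal{RS}_n:{\rm des}(\pi)=k\}$, $S_n(x)=\sum_kS(n,k)x^k$. An interior peak of $\pi$ is an index $i\in\{2,\dots,n-1\}$ with $\pi(i-1)<\pi(i)>\pi(i+1)$; ${\rm pk}(\pi)$ is their number, $P(n,k)=\#\{\pi\in\mathcal{RS}_n:{\rm pk}(\pi)=k\}$, $P_n(x)=\sum_kP(n,k)x^k$. The number of up-down runs ${\rm uprun}(\pi)$ is the number of alternating runs (maximal monotone consecutive segments) of the word $0\,\pi(1)\cdots\pi(n)$; $T(n,k)=\#\{\pi\in\mathcal{RS}_n:{\rm uprun}(\pi)=k\}$ and $T_n(x)=\sum_kT(n,k)x^k$. -}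

module Defs where

open import Data.Nat using (ℕ; zero; suc; _+_; _*_; _<ᵇ_; _≤ᵇ_; _≡ᵇ_)
open import Data.Bool using (Bool; true; false; _∧_; _∨_; not; if_then_else_)
open import Data.List using (List; []; _∷_; map; concatMap; filter; length; upTo)
open import Data.Bool.ListAction using (all; any)
open import Relation.Nullary.Decidable using (does)
open import Data.Bool.Properties using (T?)

-- A permutation of [n] = {1,…,n} is represented by its one-line notation
-- π(1) π(2) … π(n), a list of natural numbers.

range : ℕ → List ℕ
range n = map suc (upTo n)

words : List ℕ → ℕ → List (List ℕ)
words as zero    = [] ∷ []
words as (suc m) = concatMap (λ a → map (a ∷_) (words as m)) as

elem : ℕ → List ℕ → Bool
elem x ys = any (λ y → x ≡ᵇ y) ys

distinct : List ℕ → Bool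
distinct []       = true
distinct (x ∷ xs) = not (elem x xs) ∧ distinct xs

perms : ℕ → List (List ℕ)
perms n = filter (λ w → T? (distinct w)) (words (range n) n)

hasDoubleDescent : List ℕ → Bool
hasDoubleDescent (a ∷ b ∷ c ∷ w) =
  ((b <ᵇ a) ∧ (c <ᵇ b)) ∨ hasDoubleDescent (b ∷ c ∷ w)
hasDoubleDescent _ = false

restrict : ℕ → List ℕ → List ℕ
restrict k π = filter (λ x → T? (x ≤ᵇ k)) π

-- π ∈ 𝔖_n is simsun iff for every k ∈ [n] the restriction to [k]
-- has no double descent  (for k > n the restriction is π itself, k = n covers it;
-- for k = 0 it is empty)
isSimsun : ℕ → List ℕ → Bool
isSimsun n π = all (λ k → not (hasDoubleDescent (restrict k π))) (range n)

simsun : ℕ → List (List ℕ)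
simsun n = filter (λ π → T? (isSimsun n π)) (perms n)

des : List ℕ → ℕ
des (a ∷ b ∷ w) = (if b <ᵇ a then 1 else 0) + des (b ∷ w)
des _ = 0

pk : List ℕ → ℕ
pk (a ∷ b ∷ c ∷ w) = (if (a <ᵇ b) ∧ (c <ᵇ b) then 1 else 0) + pk (b ∷ c ∷ w)
pk _ = 0

turns : List ℕ → ℕ
turns (a ∷ b ∷ c ∷ w) =
  (if ((a <ᵇ b) ∧ (c <ᵇ b)) ∨ ((b <ᵇ a) ∧ (b <ᵇ c)) then 1 else 0) + turns (b ∷ c ∷ w)
turns _ = 0

-- number of alternating runs (maximal monotone consecutive segments) of a
-- word with distinct consecutive letters and length ≥ 2:
-- one more than the number of turning points; 0 for words of length ≤ 1
altRuns : List ℕ → ℕ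
altRuns []          = 0
altRuns (_ ∷ [])    = 0
altRuns w@(_ ∷ _ ∷ _) = suc (turns w)

uprun : List ℕ → ℕ
uprun π = altRuns (0 ∷ π)

count : {A : Set} → (A → Bool) → List A → ℕ
count p xs = length (filter (λ x → T? (p x)) xs)

S : ℕ → ℕ → ℕ
S n k = count (λ π → des π ≡ᵇ k) (simsun n)

P : ℕ → ℕ → ℕ
P n k = count (λ π → pk π ≡ᵇ k) (simsun n)

T : ℕ → ℕ → ℕ
T n k = count (λ π → uprun π ≡ᵇ k) (simsun n)

-- Encode a permutation by its descent word (entry i is true iff π(i) > π(i+1)). For a simsun
-- permutation it has no two consecutive descents, hence uprun π = 2 des π + 1 − [π ends with a
-- descent] and pk π = des π − [π starts with a descent]. The first identity yields the S-part
-- pointwise; the second reduces the P-part to the symmetry of the joint distribution of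
-- (des, final descent, initial descent) under swapping the two flags. Each simsun permutation of
-- [n+1] arises exactly once by inserting n+1 into one of [n] before a letter that is last or
-- followed by a larger letter, or at the end. How the triple changes depends only on the triple
-- and n, through a transition commuting with the swap, so the symmetry propagates from n = 2.
module Submission where

open import Defs
open import Data.Bool using (Bool; true; false; _∧_; _∨_; not; if_then_else_)
import Data.Bool as Bool
open import Data.Bool.Properties using (T?; T-≡; T-not-≡; T-∧; ¬-not; ∨-conicalˡ; ∨-conicalʳ; ∧-zeroʳ)
open import Data.List using (List; []; _∷_; map; concatMap; length; filter; upTo; _++_)
open import Data.List.Properties
  using (map-++; map-∘; filter-accept; filter-reject; filter-all; ∷-injectiveˡ; ∷-injectiveʳ)
open import Data.List.Membership.Propositional using (_∈_; _∉_; find; lose)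
open import Data.List.Membership.Propositional.Properties
  using (∈-filter⁻; ∈-filter⁺; ∈-map⁻; ∈-map⁺; ∈-concatMap⁻; ∈-concatMap⁺; ∈-++⁻; ∈-++⁺ˡ; ∈-++⁺ʳ;
         ∈-upTo⁻; ∈-upTo⁺)
open import Data.List.Membership.Propositional.Properties.WithK using (unique∧set⇒bag)
open import Data.List.Relation.Binary.BagAndSetEquality using (∼bag⇒↭)
open import Data.List.Relation.Binary.Permutation.Propositional using (_↭_)
open import Data.List.Relation.Binary.Permutation.Propositional.Properties using (map⁺)
open import Data.List.Relation.Unary.All as All using (All; []; _∷_)
import Data.List.Relation.Unary.All.Properties as Allₚ
open import Data.List.Relation.Unary.All.Properties
  using (all⁺; all⁻; ¬Any⇒All¬; All¬⇒¬Any; all-filter; filter⁺)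
open import Data.List.Relation.Unary.Any as Any using (Any; here; there)
open import Data.List.Relation.Unary.Any.Properties using (any⁺; any⁻)
open import Data.List.Relation.Unary.AllPairs using ([]; _∷_)
open import Data.List.Relation.Unary.Linked using (Linked; _∷_)
open import Data.List.Relation.Unary.Linked.Properties using (AllPairs⇒Linked)
open import Data.List.Relation.Unary.Unique.Propositional using (Unique)
import Data.List.Relation.Unary.Unique.Propositional.Properties as Unique
open import Data.Nat using (ℕ; zero; suc; _+_; _*_; _∸_; _≤_; _<_; _≥_; _<ᵇ_; _≤ᵇ_; _≡ᵇ_; z≤n; s≤s)
open import Data.Nat.ListAction using (sum)
open import Data.Nat.ListAction.Properties using (sum-++; sum-↭)
open import Data.Nat.Properties
  using (_≟_; _≤?_; ≤-refl; ≤-antisym; ≤-<-trans; <⇒≤; <⇒≱; <⇒≢; ≤⇒≯; ≰⇒>; ≤∧≢⇒<; <-cmp; n<1+n; 1+n≰n;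
         m<1+n⇒m≤n; m≤n⇒m≤1+n; suc-injective; +-comm; +-suc; +-identityʳ; +-cancelʳ-≡; *-suc; m+n∸n≡m;
         <ᵇ⇒<; <⇒<ᵇ; ≤ᵇ⇒≤; ≤⇒≤ᵇ; ≡ᵇ⇒≡; ≡⇒≡ᵇ)
open import Data.List.Membership.DecPropositional _≟_ using (_∈?_)
open import Data.Nat.Tactic.RingSolver using (solve-∀)
open import Data.Product using (_×_; _,_; proj₁; proj₂; ∃)
open import Data.Sum using (_⊎_; inj₁; inj₂; [_,_]′)
open import Function using (_∘_; id)
open import Function.Bundles using (Equivalence; mk⇔)
open import Relation.Binary.Definitions using (tri<; tri≈; tri>)
open import Relation.Binary.PropositionalEquality
  using (_≡_; _≢_; refl; sym; trans; cong; cong₂; subst; module ≡-Reasoning)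
open import Relation.Nullary using (¬_; yes; no; contradiction)

ind : Bool → ℕ
ind b = if b then 1 else 0

sumBy : {A : Set} → (A → ℕ) → List A → ℕ
sumBy f xs = sum (map f xs)

private
  variable
    A B : Set

sumBy-++ : (f : A → ℕ) (xs ys : List A) → sumBy f (xs ++ ys) ≡ sumBy f xs + sumBy f ys
sumBy-++ f xs ys = trans (cong sum (map-++ f xs ys)) (sum-++ (map f xs) (map f ys))

sumBy-map : (f : B → ℕ) (g : A → B) (xs : List A) → sumBy f (map g xs) ≡ sumBy (f ∘ g) xs
sumBy-map f g xs = cong sum (sym (map-∘ xs))

sumBy-concatMap : (f : B → ℕ) (g : A → List B) (xs : List A) →
  sumBy f (concatMap g xs) ≡ sumBy (sumBy f ∘ g) xs
sumBy-concatMap f g [] = refl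
sumBy-concatMap f g (x ∷ xs) =
  trans (sumBy-++ f (g x) (concatMap g xs)) (cong (sumBy f (g x) +_) (sumBy-concatMap f g xs))

sumBy-cong : {f g : A → ℕ} (xs : List A) → (∀ {x} → x ∈ xs → f x ≡ g x) → sumBy f xs ≡ sumBy g xs
sumBy-cong [] eq = refl
sumBy-cong (x ∷ xs) eq = cong₂ _+_ (eq (here refl)) (sumBy-cong xs (eq ∘ there))

sumBy-+ : (f g : A → ℕ) (xs : List A) → sumBy (λ x → f x + g x) xs ≡ sumBy f xs + sumBy g xs
sumBy-+ f g [] = refl
sumBy-+ f g (x ∷ xs) = trans (cong (f x + g x +_) (sumBy-+ f g xs)) (rearrange (f x) (g x) _ _)
  where
  rearrange : ∀ a b c d → a + b + (c + d) ≡ a + c + (b + d)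
  rearrange = solve-∀

sumBy-↭ : (f : A → ℕ) {xs ys : List A} → xs ↭ ys → sumBy f xs ≡ sumBy f ys
sumBy-↭ f p = sum-↭ (map⁺ f p)

count≡sumBy : (p : A → Bool) (xs : List A) → count p xs ≡ sumBy (ind ∘ p) xs
count≡sumBy p [] = refl
count≡sumBy p (x ∷ xs) with p x
... | true  = cong suc (count≡sumBy p xs)
... | false = count≡sumBy p xs

count+count≡sumBy : (p q : A → Bool) (f : A → ℕ) (xs : List A) →
  (∀ {x} → x ∈ xs → ind (p x) + ind (q x) ≡ f x) → count p xs + count q xs ≡ sumBy f xs
count+count≡sumBy p q f xs split =
  trans (cong₂ _+_ (count≡sumBy p xs) (count≡sumBy q xs))
        (trans (sym (sumBy-+ (ind ∘ p) (ind ∘ q) xs)) (sumBy-cong xs split))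

T-not⇒¬T : ∀ {b} → Bool.T (not b) → ¬ Bool.T b
T-not⇒¬T {false} _ ()

¬T⇒T-not : ∀ {b} → ¬ Bool.T b → Bool.T (not b)
¬T⇒T-not {false} _  = _
¬T⇒T-not {true}  ¬t = ¬t _

<ᵇ-true : ∀ {m n} → m < n → (m <ᵇ n) ≡ true
<ᵇ-true = Equivalence.to T-≡ ∘ <⇒<ᵇ

<ᵇ-false : ∀ {m n} → n ≤ m → (m <ᵇ n) ≡ false
<ᵇ-false {m} {n} n≤m = ¬-not (λ m<ᵇn → ≤⇒≯ n≤m (<ᵇ⇒< m n (Equivalence.from T-≡ m<ᵇn)))

<ᵇ-flip : ∀ {m n} → m ≢ n → (m <ᵇ n) ≡ not (n <ᵇ m)
<ᵇ-flip {m} {n} m≢n with <-cmp m n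
... | tri< m<n _ _ rewrite <ᵇ-true m<n | <ᵇ-false (<⇒≤ m<n) = refl
... | tri≈ _ m≡n _ = contradiction m≡n m≢n
... | tri> _ _ n<m rewrite <ᵇ-true n<m | <ᵇ-false (<⇒≤ n<m) = refl

Unique-concatMap : (f : A → List B) {xs : List A} → Unique xs → (∀ {x} → x ∈ xs → Unique (f x)) →
  (∀ {x y v} → x ∈ xs → y ∈ xs → v ∈ f x → v ∈ f y → x ≡ y) → Unique (concatMap f xs)
Unique-concatMap f {[]}     _        _       _        = []
Unique-concatMap f {x ∷ xs} (x∉ ∷ u) uniqueF disjoint =
  Unique.++⁺ (uniqueF (here refl))
             (Unique-concatMap f u (uniqueF ∘ there) (λ x∈ y∈ → disjoint (there x∈) (there y∈)))
             (λ (v∈fx , v∈rest) → let y , y∈ , v∈fy = find (∈-concatMap⁻ f {xs = xs} v∈rest) in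
                All¬⇒¬Any x∉ (subst (_∈ xs) (sym (disjoint (here refl) (there y∈) v∈fx v∈fy)) y∈))

-- 2 * suc k computes to suc (k + suc (k + 0)); +-suc exposes the second suc.
double-≡ᵇ-split : ∀ d k e → ind (2 * d + ind e ≡ᵇ 2 * k) + ind (2 * d + ind e ≡ᵇ suc (2 * k)) ≡ ind (d ≡ᵇ k)
double-≡ᵇ-split zero    zero    false = refl
double-≡ᵇ-split zero    zero    true  = refl
double-≡ᵇ-split zero    (suc k) false = refl
double-≡ᵇ-split zero    (suc k) true  rewrite +-suc k (k + 0) = refl
double-≡ᵇ-split (suc d) zero    e     rewrite +-suc d (d + 0) = refl
double-≡ᵇ-split (suc d) (suc k) e     rewrite +-suc d (d + 0) | +-suc k (k + 0) = double-≡ᵇ-split d k e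

halving-split : ∀ {m} d k e → m ≡ 2 * d + ind e → ind (m ≡ᵇ 2 * k) + ind (m ≡ᵇ 2 * k + 1) ≡ ind (d ≡ᵇ k)
halving-split d k e refl rewrite +-comm (2 * k) 1 = double-≡ᵇ-split d k e

halving-split-suc : ∀ {m} d k e → m ≡ 2 * d + ind e →
  ind (suc m ≡ᵇ 2 * k + 1) + ind (suc m ≡ᵇ 2 * k + 2) ≡ ind (d ≡ᵇ k)
halving-split-suc d k e refl rewrite +-suc (2 * k) 1 | +-comm (2 * k) 1 = double-≡ᵇ-split d k e

suc-from-parity : ∀ u L D → u + ind L ≡ 2 * D → suc u ≡ 2 * D + ind (not L)
suc-from-parity u false D h = trans (cong suc (trans (sym (+-identityʳ u)) h)) (+-comm 1 (2 * D))
suc-from-parity u true  D h = trans (trans (+-comm 1 u) h) (sym (+-identityʳ (2 * D)))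

from-parity : ∀ u L D → u + ind L ≡ 2 * D → u ≡ 2 * (D ∸ ind L) + ind L
from-parity u false D       h = trans (trans (sym (+-identityʳ u)) h) (sym (+-identityʳ (2 * D)))
from-parity u true  zero    h with trans (+-comm 1 u) h
... | ()
from-parity u true  (suc D) h = +-cancelʳ-≡ 1 u (2 * D + 1) (trans h (rearrange D))
  where
  rearrange : ∀ D → 2 * suc D ≡ 2 * D + 1 + 1
  rearrange = solve-∀

-- Descent words

descentCount : List Bool → ℕ
descentCount []      = 0
descentCount (d ∷ p) = ind d + descentCount p

initialDescent : List Bool → Bool
initialDescent []      = false
initialDescent (d ∷ _) = d

finalDescent : List Bool → Bool
finalDescent []          = false
finalDescent (d ∷ [])    = d
finalDescent (_ ∷ e ∷ p) = finalDescent (e ∷ p)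

hasConsecutiveTrues : List Bool → Bool
hasConsecutiveTrues (d ∷ e ∷ p) = (d ∧ e) ∨ hasConsecutiveTrues (e ∷ p)
hasConsecutiveTrues _           = false

NoConsecutiveTrues : List Bool → Set
NoConsecutiveTrues p = hasConsecutiveTrues p ≡ false

peakCount : List Bool → ℕ
peakCount (d ∷ e ∷ p) = ind (not d ∧ e) + peakCount (e ∷ p)
peakCount _           = 0

turnCount : List Bool → ℕ
turnCount (d ∷ e ∷ p) = ind ((not d ∧ e) ∨ (d ∧ not e)) + turnCount (e ∷ p)
turnCount _           = 0

doubleAscentCount : List Bool → ℕ
doubleAscentCount (d ∷ e ∷ p) = ind (not d ∧ not e) + doubleAscentCount (e ∷ p)
doubleAscentCount _           = 0

noConsecutiveTrues-tail : ∀ d p → NoConsecutiveTrues (d ∷ p) → NoConsecutiveTrues p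
noConsecutiveTrues-tail d []      _ = refl
noConsecutiveTrues-tail d (e ∷ p) h = ∨-conicalʳ (d ∧ e) _ h

noConsecutiveTrues-head : ∀ d e p → NoConsecutiveTrues (d ∷ e ∷ p) → (d ∧ e) ≡ false
noConsecutiveTrues-head d e p h = ∨-conicalˡ (d ∧ e) _ h

noConsecutiveTrues-∷ : ∀ d e p → (d ∧ e) ≡ false → NoConsecutiveTrues (e ∷ p) →
  NoConsecutiveTrues (d ∷ e ∷ p)
noConsecutiveTrues-∷ d e p de h rewrite de = h

noConsecutiveTrues-false∷ : ∀ p → NoConsecutiveTrues p → NoConsecutiveTrues (false ∷ p)
noConsecutiveTrues-false∷ []      _ = refl
noConsecutiveTrues-false∷ (_ ∷ _) h = h

noConsecutiveTrues-∷false∷ : ∀ d p → NoConsecutiveTrues p → NoConsecutiveTrues (d ∷ false ∷ p)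
noConsecutiveTrues-∷false∷ d p h =
  noConsecutiveTrues-∷ d false p (∧-zeroʳ d) (noConsecutiveTrues-false∷ p h)

turnCount+ends≡2*descentCount : ∀ p → NoConsecutiveTrues p →
  turnCount p + ind (initialDescent p) + ind (finalDescent p) ≡ 2 * descentCount p
turnCount+ends≡2*descentCount []               _ = refl
turnCount+ends≡2*descentCount (false ∷ [])     _ = refl
turnCount+ends≡2*descentCount (true ∷ [])      _ = refl
turnCount+ends≡2*descentCount (false ∷ false ∷ p) h = turnCount+ends≡2*descentCount (false ∷ p) h
turnCount+ends≡2*descentCount (false ∷ true ∷ p)  h =
  trans (rearrange (turnCount (true ∷ p)) _) (turnCount+ends≡2*descentCount (true ∷ p) h)
  where
  rearrange : ∀ t f → suc (t + 0 + f) ≡ t + 1 + f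
  rearrange = solve-∀
turnCount+ends≡2*descentCount (true ∷ true ∷ p)   ()
turnCount+ends≡2*descentCount (true ∷ false ∷ p)  h =
  trans (rearrange (turnCount (false ∷ p)) _)
        (trans (cong (2 +_) (turnCount+ends≡2*descentCount (false ∷ p) h)) (sym (*-suc 2 (descentCount p))))
  where
  rearrange : ∀ t f → suc (t + 1 + f) ≡ 2 + (t + 0 + f)
  rearrange = solve-∀

turnCount-false∷ : ∀ p → NoConsecutiveTrues p →
  turnCount (false ∷ p) + ind (finalDescent p) ≡ 2 * descentCount p
turnCount-false∷ []      _   = refl
turnCount-false∷ (d ∷ p) nct = trans (cong (_+ ind (finalDescent (d ∷ p))) (sym (+-identityʳ _)))
                                     (turnCount+ends≡2*descentCount (false ∷ d ∷ p) nct)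

peakCount+initial≡descentCount : ∀ p → NoConsecutiveTrues p →
  peakCount p + ind (initialDescent p) ≡ descentCount p
peakCount+initial≡descentCount []                  _ = refl
peakCount+initial≡descentCount (d ∷ [])            _ = sym (+-identityʳ (ind d))
peakCount+initial≡descentCount (false ∷ false ∷ p) h = peakCount+initial≡descentCount (false ∷ p) h
peakCount+initial≡descentCount (false ∷ true ∷ p)  h =
  trans (rearrange (peakCount (true ∷ p))) (peakCount+initial≡descentCount (true ∷ p) h)
  where
  rearrange : ∀ t → suc (t + 0) ≡ t + 1
  rearrange = solve-∀
peakCount+initial≡descentCount (true ∷ true ∷ p)   ()
peakCount+initial≡descentCount (true ∷ false ∷ p)  h =
  trans (rearrange (peakCount (false ∷ p))) (cong suc (peakCount+initial≡descentCount (false ∷ p) h))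
  where
  rearrange : ∀ t → t + 1 ≡ suc (t + 0)
  rearrange = solve-∀

doubleAscentCount+descents≡length+ends : ∀ d p → NoConsecutiveTrues (d ∷ p) →
  doubleAscentCount (d ∷ p) + (2 + 2 * descentCount (d ∷ p))
    ≡ length (d ∷ p) + 1 + ind (finalDescent (d ∷ p)) + ind (initialDescent (d ∷ p))
doubleAscentCount+descents≡length+ends false []            _ = refl
doubleAscentCount+descents≡length+ends true  []            _ = refl
doubleAscentCount+descents≡length+ends false (false ∷ p) h =
  cong suc (doubleAscentCount+descents≡length+ends false p h)
doubleAscentCount+descents≡length+ends false (true ∷ p)  h =
  trans (doubleAscentCount+descents≡length+ends true p h) (rearrange (length p) _)
  where
  rearrange : ∀ ℓ f → suc ℓ + 1 + f + 1 ≡ suc (suc ℓ + 1 + f + 0)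
  rearrange = solve-∀
doubleAscentCount+descents≡length+ends true  (true ∷ p)  ()
doubleAscentCount+descents≡length+ends true  (false ∷ p) h =
  trans (rearrange (doubleAscentCount (false ∷ p)) (descentCount p))
        (trans (cong (2 +_) (doubleAscentCount+descents≡length+ends false p h)) (rearrange′ (length p) _))
  where
  rearrange : ∀ a D → a + (2 + 2 * (1 + D)) ≡ 2 + (a + (2 + 2 * D))
  rearrange = solve-∀
  rearrange′ : ∀ ℓ f → 2 + (suc ℓ + 1 + f + 0) ≡ suc (suc ℓ) + 1 + f + 1
  rearrange′ = solve-∀

-- The descent words of the words obtained by inserting a new maximum into a word with descent
-- word p, in front of it (leadSlot) or after its first letter (laterSlots); see descentWord-ins.
leadSlot : List Bool → List (List Bool)
leadSlot p = if initialDescent p then [] else (true ∷ p) ∷ []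

laterSlots : List Bool → List (List Bool)
laterSlots []      = (false ∷ []) ∷ []
laterSlots (d ∷ p) = map (false ∷_) (leadSlot p) ++ map (d ∷_) (laterSlots p)

insertionSlots : List Bool → List (List Bool)
insertionSlots p = leadSlot p ++ laterSlots p

leadSlot-noConsecutiveTrues : ∀ p → NoConsecutiveTrues p → All NoConsecutiveTrues (leadSlot p)
leadSlot-noConsecutiveTrues []          _ = refl ∷ []
leadSlot-noConsecutiveTrues (false ∷ p) h = h ∷ []
leadSlot-noConsecutiveTrues (true ∷ p)  _ = []

laterSlots-noConsecutiveTrues : ∀ d p → NoConsecutiveTrues (d ∷ p) →
  All (λ q → NoConsecutiveTrues (d ∷ q)) (laterSlots p)
laterSlots-noConsecutiveTrues d []      _ = noConsecutiveTrues-∷false∷ d [] refl ∷ []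
laterSlots-noConsecutiveTrues d (e ∷ p) h =
  Allₚ.++⁺ (Allₚ.map⁺ (All.map (λ {r} → noConsecutiveTrues-∷false∷ d r)
                               (leadSlot-noConsecutiveTrues p (noConsecutiveTrues-tail e p h′))))
           (Allₚ.map⁺ (All.map (λ {q} → noConsecutiveTrues-∷ d e q (noConsecutiveTrues-head d e p h))
                               (laterSlots-noConsecutiveTrues e p h′)))
  where
  h′ : NoConsecutiveTrues (e ∷ p)
  h′ = noConsecutiveTrues-tail d (e ∷ p) h

insertionSlots-noConsecutiveTrues : ∀ p → NoConsecutiveTrues p → All NoConsecutiveTrues (insertionSlots p)
insertionSlots-noConsecutiveTrues p h =
  Allₚ.++⁺ (leadSlot-noConsecutiveTrues p h)
           (All.map (λ {q} → noConsecutiveTrues-tail false q)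
                    (laterSlots-noConsecutiveTrues false p (noConsecutiveTrues-false∷ p h)))

sumBy-leadSlot : ∀ (f : List Bool → ℕ) p → sumBy f (leadSlot p) ≡ ind (not (initialDescent p)) * f (true ∷ p)
sumBy-leadSlot f p with initialDescent p
... | true  = refl
... | false = refl

finalDescent-laterSlots : ∀ d p {q} → q ∈ laterSlots p → finalDescent (d ∷ q) ≡ finalDescent q
finalDescent-laterSlots d []      (here refl) = refl
finalDescent-laterSlots d (e ∷ p) q∈ with ∈-++⁻ (map (false ∷_) (leadSlot p)) q∈
... | inj₁ q∈lead  with ∈-map⁻ (false ∷_) q∈lead
...   | _ , _ , refl = refl
finalDescent-laterSlots d (e ∷ p) q∈ | inj₂ q∈later with ∈-map⁻ (e ∷_) q∈later
...   | _ , _ , refl = refl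

sumBy-laterSlots-∷ : ∀ (f : List Bool → ℕ) d p →
  sumBy f (laterSlots (d ∷ p))
    ≡ ind (not (initialDescent p)) * f (false ∷ true ∷ p) + sumBy (f ∘ (d ∷_)) (laterSlots p)
sumBy-laterSlots-∷ f d p =
  trans (sumBy-++ f (map (false ∷_) (leadSlot p)) (map (d ∷_) (laterSlots p)))
        (cong₂ _+_ (trans (sumBy-map f (false ∷_) (leadSlot p)) (sumBy-leadSlot (f ∘ (false ∷_)) p))
                   (sumBy-map f (d ∷_) (laterSlots p)))

sumBy-laterSlots-finalDescent : ∀ (h : ℕ → Bool → ℕ) d p →
  sumBy (λ q → h (descentCount (d ∷ q)) (finalDescent (d ∷ q))) (laterSlots p)
    ≡ sumBy (λ q → h (ind d + descentCount q) (finalDescent q)) (laterSlots p)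
sumBy-laterSlots-finalDescent h d p =
  sumBy-cong (laterSlots p) (λ q∈ → cong (h _) (finalDescent-laterSlots d p q∈))

-- Slots after the first letter: inside one of a double ascents, before the last letter (unless
-- L), right after one of the D descents, and at the end.
laterSlotWeight : (ℕ → Bool → ℕ) → ℕ → ℕ → Bool → ℕ
laterSlotWeight h a D L = a * h (suc D) L + ind (not L) * h (suc D) true + D * h D L + h D false

laterSlotWeight-∷ : ∀ h d e a D L → (d ∧ e) ≡ false →
  ind (not e) * h (suc D) L + laterSlotWeight (λ D′ → h (ind d + D′)) a D L
    ≡ laterSlotWeight h (ind (not d ∧ not e) + a) (ind d + D) L
laterSlotWeight-∷ h false e a D L _ = rearrange (ind (not e)) a D _ _ _ _
  where
  rearrange : ∀ x a D u v w z → x * u + (a * u + v + D * w + z) ≡ (x + a) * u + v + D * w + z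
  rearrange = solve-∀
laterSlotWeight-∷ h true false a D L _ = rearrange a D _ _ _ _
  where
  rearrange : ∀ a D u v w z → 1 * u + (a * v + w + D * u + z) ≡ a * v + w + (1 + D) * u + z
  rearrange = solve-∀

laterSlots-sum : ∀ (h : ℕ → Bool → ℕ) d p → NoConsecutiveTrues (d ∷ p) →
  sumBy (λ q → h (descentCount q) (finalDescent q)) (laterSlots (d ∷ p))
    ≡ laterSlotWeight h (doubleAscentCount (d ∷ p)) (descentCount (d ∷ p)) (finalDescent (d ∷ p))
laterSlots-sum h false [] _ = rearrange (h 1 true) (h 0 false)
  where
  rearrange : ∀ u v → u + (v + 0) ≡ u + 0 + 0 + v
  rearrange = solve-∀
laterSlots-sum h true  [] _ = rearrange (h 1 true) (h 1 false)
  where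
  rearrange : ∀ u v → u + (v + 0) ≡ u + 0 + v
  rearrange = solve-∀
laterSlots-sum h d (e ∷ p) nct =
  begin
    sumBy hq (laterSlots (d ∷ e ∷ p))
  ≡⟨ sumBy-laterSlots-∷ hq d (e ∷ p) ⟩
    ind (not e) * h (suc D) L + sumBy (hq ∘ (d ∷_)) (laterSlots (e ∷ p))
  ≡⟨ cong (ind (not e) * h (suc D) L +_)
          (trans (sumBy-laterSlots-finalDescent h d (e ∷ p))
                 (laterSlots-sum (λ D′ → h (ind d + D′)) e p (noConsecutiveTrues-tail d (e ∷ p) nct))) ⟩
    ind (not e) * h (suc D) L + laterSlotWeight (λ D′ → h (ind d + D′)) (doubleAscentCount (e ∷ p)) D L
  ≡⟨ laterSlotWeight-∷ h d e (doubleAscentCount (e ∷ p)) D L (noConsecutiveTrues-head d e p nct) ⟩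
    laterSlotWeight h (doubleAscentCount (d ∷ e ∷ p)) (ind d + D) L
  ∎
  where
  open ≡-Reasoning
  hq : List Bool → ℕ
  hq q = h (descentCount q) (finalDescent q)
  D = descentCount (e ∷ p)
  L = finalDescent (e ∷ p)

Profile : Set
Profile = ℕ × Bool × Bool

profile : List Bool → Profile
profile p = descentCount p , finalDescent p , initialDescent p

mirror : Profile → Profile
mirror (D , L , I) = D , I , L

-- Total weight of the profiles reached by inserting a new maximum into a word with profile
-- (D , L , I) and a interior double ascents. Slots: in front (unless I), before the last letter
-- (unless L), inside a double ascent, right after a descent (after the first one I becomes
-- false), and at the end.
afterInsertion : (Profile → ℕ) → ℕ → Profile → ℕ
afterInsertion g a (D , false , false) =
  g (suc D , false , true) + g (suc D , true , false) + a * g (suc D , false , false)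
    + suc D * g (D , false , false)
afterInsertion g a (D , true , false) =
  g (suc D , true , true) + a * g (suc D , true , false) + D * g (D , true , false) + g (D , false , false)
afterInsertion g a (D , false , true) =
  g (suc D , true , true) + a * g (suc D , false , true) + D * g (D , false , true) + g (D , false , false)
afterInsertion g a (D , true , true) =
  a * g (suc D , true , true) + (D ∸ 1) * g (D , true , true) + g (D , true , false) + g (D , false , true)

afterInsertion-mirror : ∀ g a s → afterInsertion (g ∘ mirror) a s ≡ afterInsertion g a (mirror s)
afterInsertion-mirror g a (D , false , false) =
  cong (λ x → x + a * g (suc D , false , false) + suc D * g (D , false , false))
       (+-comm (g (suc D , true , false)) (g (suc D , false , true)))
afterInsertion-mirror g a (D , true , false) = refl
afterInsertion-mirror g a (D , false , true) = refl
afterInsertion-mirror g a (D , true , true) = rearrange _ (g (D , false , true)) (g (D , true , false))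
  where
  rearrange : ∀ x y z → x + y + z ≡ x + z + y
  rearrange = solve-∀

afterInsertion-slots : ∀ g d e a D L → (d ∧ e) ≡ false →
  ind (not d) * g (suc (ind d + D) , L , true)
    + (ind (not e) * g (suc D , L , false) + laterSlotWeight (λ D′ L′ → g (ind d + D′ , L′ , d)) a D L)
    ≡ afterInsertion g (ind (not d ∧ not e) + a) (ind d + D , L , d)
afterInsertion-slots g false e a D false _ =
  rearrange (ind (not e)) a D (g (suc D , false , true)) (g (suc D , false , false))
            (g (suc D , true , false)) (g (D , false , false))
  where
  rearrange : ∀ x a D u v w z →
    1 * u + (x * v + (a * v + 1 * w + D * z + z)) ≡ u + w + (x + a) * v + suc D * z
  rearrange = solve-∀
afterInsertion-slots g false e a D true _ =
  rearrange (ind (not e)) a D (g (suc D , true , true)) (g (suc D , true , false))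
            (g (D , false , false)) (g (D , true , false))
  where
  rearrange : ∀ x a D u v w z →
    1 * u + (x * v + (a * v + 0 * w + D * z + w)) ≡ u + (x + a) * v + D * z + w
  rearrange = solve-∀
afterInsertion-slots g true false a D false _ =
  rearrange a D (g (suc (suc D) , false , true)) (g (suc D , false , false))
            (g (suc (suc D) , true , true)) (g (suc D , false , true))
  where
  rearrange : ∀ a D u v w z →
    0 * u + (1 * v + (a * u + 1 * w + D * z + z)) ≡ w + a * u + suc D * z + v
  rearrange = solve-∀
afterInsertion-slots g true false a D true _ =
  rearrange a D (g (suc (suc D) , true , true)) (g (suc D , true , true))
            (g (suc D , true , false)) (g (suc D , false , true))
  where
  rearrange : ∀ a D u v w z → 0 * u + (1 * w + (a * u + 0 * u + D * v + z)) ≡ a * u + D * v + w + z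
  rearrange = solve-∀

insertionSlots-sum : ∀ (g : Profile → ℕ) d p → NoConsecutiveTrues (d ∷ p) →
  sumBy (g ∘ profile) (insertionSlots (d ∷ p)) ≡ afterInsertion g (doubleAscentCount (d ∷ p)) (profile (d ∷ p))
insertionSlots-sum g false [] _ =
  rearrange (g (1 , false , true)) (g (1 , true , false)) (g (0 , false , false))
  where
  rearrange : ∀ u v w → u + (v + (w + 0)) ≡ u + v + 0 + (w + 0)
  rearrange = solve-∀
insertionSlots-sum g true  [] _ = cong (g (1 , true , false) +_) (+-identityʳ (g (1 , false , true)))
insertionSlots-sum g d (e ∷ p) nct =
  begin
    sumBy gp (leadSlot (d ∷ e ∷ p) ++ laterSlots (d ∷ e ∷ p))
  ≡⟨ sumBy-++ gp (leadSlot (d ∷ e ∷ p)) (laterSlots (d ∷ e ∷ p)) ⟩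
    sumBy gp (leadSlot (d ∷ e ∷ p)) + sumBy gp (laterSlots (d ∷ e ∷ p))
  ≡⟨ cong₂ _+_ (sumBy-leadSlot gp (d ∷ e ∷ p)) (sumBy-laterSlots-∷ gp d (e ∷ p)) ⟩
    ind (not d) * g (suc (ind d + D) , L , true)
      + (ind (not e) * g (suc D , L , false) + sumBy (gp ∘ (d ∷_)) (laterSlots (e ∷ p)))
  ≡⟨ cong (λ x → ind (not d) * g (suc (ind d + D) , L , true) + (ind (not e) * g (suc D , L , false) + x))
          (trans (sumBy-laterSlots-finalDescent (λ D′ L′ → g (D′ , L′ , d)) d (e ∷ p))
                 (laterSlots-sum (λ D′ L′ → g (ind d + D′ , L′ , d)) e p
                                 (noConsecutiveTrues-tail d (e ∷ p) nct))) ⟩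
    ind (not d) * g (suc (ind d + D) , L , true)
      + (ind (not e) * g (suc D , L , false)
         + laterSlotWeight (λ D′ L′ → g (ind d + D′ , L′ , d)) (doubleAscentCount (e ∷ p)) D L)
  ≡⟨ afterInsertion-slots g d e (doubleAscentCount (e ∷ p)) D L (noConsecutiveTrues-head d e p nct) ⟩
    afterInsertion g (doubleAscentCount (d ∷ e ∷ p)) (profile (d ∷ e ∷ p))
  ∎
  where
  open ≡-Reasoning
  gp : List Bool → ℕ
  gp = g ∘ profile
  D = descentCount (e ∷ p)
  L = finalDescent (e ∷ p)

descentWord : List ℕ → List Bool
descentWord (a ∷ b ∷ w) = (b <ᵇ a) ∷ descentWord (b ∷ w)
descentWord _           = []

des-descentWord : ∀ w → des w ≡ descentCount (descentWord w)
des-descentWord (a ∷ b ∷ w) = cong (ind (b <ᵇ a) +_) (des-descentWord (b ∷ w))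
des-descentWord (_ ∷ [])    = refl
des-descentWord []          = refl

hasDoubleDescent-descentWord : ∀ w → hasDoubleDescent w ≡ hasConsecutiveTrues (descentWord w)
hasDoubleDescent-descentWord (a ∷ b ∷ c ∷ w) =
  cong (((b <ᵇ a) ∧ (c <ᵇ b)) ∨_) (hasDoubleDescent-descentWord (b ∷ c ∷ w))
hasDoubleDescent-descentWord (_ ∷ _ ∷ []) = refl
hasDoubleDescent-descentWord (_ ∷ [])     = refl
hasDoubleDescent-descentWord []           = refl

pk-descentWord : ∀ {w} → Linked _≢_ w → pk w ≡ peakCount (descentWord w)
pk-descentWord {a ∷ b ∷ c ∷ w} (a≢b ∷ bcw) =
  cong₂ _+_ (cong (λ x → ind (x ∧ (c <ᵇ b))) (<ᵇ-flip a≢b)) (pk-descentWord bcw)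
pk-descentWord {_ ∷ _ ∷ []} _ = refl
pk-descentWord {_ ∷ []}     _ = refl
pk-descentWord {[]}         _ = refl

turns-descentWord : ∀ {w} → Linked _≢_ w → turns w ≡ turnCount (descentWord w)
turns-descentWord {a ∷ b ∷ c ∷ w} (a≢b ∷ bcw@(b≢c ∷ _)) =
  cong₂ _+_ (cong₂ (λ x y → ind ((x ∧ (c <ᵇ b)) ∨ ((b <ᵇ a) ∧ y))) (<ᵇ-flip a≢b) (<ᵇ-flip b≢c))
            (turns-descentWord bcw)
turns-descentWord {_ ∷ _ ∷ []} _ = refl
turns-descentWord {_ ∷ []}     _ = refl
turns-descentWord {[]}         _ = refl

length-descentWord : ∀ a w → length (descentWord (a ∷ w)) ≡ length w
length-descentWord a []      = refl
length-descentWord a (b ∷ w) = cong suc (length-descentWord b w)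

-- Inserting a new maximum x right before c creates a double descent x > c > d exactly
-- when c is followed by a smaller letter d; these are the admissible positions.
canLead : List ℕ → Bool
canLead (c ∷ d ∷ _) = c <ᵇ d
canLead _           = true

leadIns : ℕ → List ℕ → List (List ℕ)
leadIns x w = if canLead w then (x ∷ w) ∷ [] else []

ins : ℕ → List ℕ → List (List ℕ)
ins x []      = (x ∷ []) ∷ []
ins x (b ∷ w) = leadIns x (b ∷ w) ++ map (b ∷_) (ins x w)

descentWord-leadIns : ∀ {x c} w → c < x → Linked _≢_ (c ∷ w) →
  map descentWord (leadIns x (c ∷ w)) ≡ leadSlot (descentWord (c ∷ w))
descentWord-leadIns []      c<x _ = cong (λ b → (b ∷ []) ∷ []) (<ᵇ-true c<x)
descentWord-leadIns {x} {c} (d ∷ w) c<x (c≢d ∷ _) rewrite <ᵇ-flip c≢d with d <ᵇ c in d<ᵇc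
... | true  = refl
... | false = cong₂ (λ b e → (b ∷ e ∷ descentWord (d ∷ w)) ∷ []) (<ᵇ-true c<x) d<ᵇc

descentWord-∷-leadIns : ∀ {x b} w → b < x →
  map (descentWord ∘ (b ∷_)) (leadIns x w) ≡ map ((false ∷_) ∘ descentWord) (leadIns x w)
descentWord-∷-leadIns w b<x with canLead w
... | true  rewrite <ᵇ-false (<⇒≤ b<x) = refl
... | false = refl

descentWord-laterIns : ∀ {x b} w → b < x → All (_< x) w → Linked _≢_ (b ∷ w) →
  map descentWord (map (b ∷_) (ins x w)) ≡ laterSlots (descentWord (b ∷ w))
descentWord-laterIns []  b<x _ _ rewrite <ᵇ-false (<⇒≤ b<x) = refl
descentWord-laterIns {x} {b} (c ∷ w) b<x (c<x ∷ w<x) (_ ∷ cw) =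
  begin
    map descentWord (map (b ∷_) (leadIns x (c ∷ w) ++ map (c ∷_) (ins x w)))
  ≡⟨ sym (map-∘ (leadIns x (c ∷ w) ++ map (c ∷_) (ins x w))) ⟩
    map (descentWord ∘ (b ∷_)) (leadIns x (c ∷ w) ++ map (c ∷_) (ins x w))
  ≡⟨ map-++ (descentWord ∘ (b ∷_)) (leadIns x (c ∷ w)) (map (c ∷_) (ins x w)) ⟩
    map (descentWord ∘ (b ∷_)) (leadIns x (c ∷ w)) ++ map (descentWord ∘ (b ∷_)) (map (c ∷_) (ins x w))
  ≡⟨ cong₂ _++_ (trans (descentWord-∷-leadIns (c ∷ w) b<x) (map-∘ (leadIns x (c ∷ w))))
                (descentWord-∷-∷ (ins x w)) ⟩
    map (false ∷_) (map descentWord (leadIns x (c ∷ w)))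
      ++ map ((c <ᵇ b) ∷_) (map descentWord (map (c ∷_) (ins x w)))
  ≡⟨ cong₂ (λ l r → map (false ∷_) l ++ map ((c <ᵇ b) ∷_) r)
           (descentWord-leadIns w c<x cw) (descentWord-laterIns w c<x w<x cw) ⟩
    laterSlots (descentWord (b ∷ c ∷ w))
  ∎
  where
  open ≡-Reasoning
  descentWord-∷-∷ : ∀ vs → map (descentWord ∘ (b ∷_)) (map (c ∷_) vs)
                             ≡ map ((c <ᵇ b) ∷_) (map descentWord (map (c ∷_) vs))
  descentWord-∷-∷ []       = refl
  descentWord-∷-∷ (v ∷ vs) = cong (_ ∷_) (descentWord-∷-∷ vs)

descentWord-ins : ∀ {x c} w → All (_< x) (c ∷ w) → Linked _≢_ (c ∷ w) →
  map descentWord (ins x (c ∷ w)) ≡ insertionSlots (descentWord (c ∷ w))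
descentWord-ins {x} {c} w (c<x ∷ w<x) cw =
  trans (map-++ descentWord (leadIns x (c ∷ w)) (map (c ∷_) (ins x w)))
        (cong₂ _++_ (descentWord-leadIns w c<x cw) (descentWord-laterIns w c<x w<x cw))

restrict-∷-≤ : ∀ {k a} w → a ≤ k → restrict k (a ∷ w) ≡ a ∷ restrict k w
restrict-∷-≤ {k} w a≤k = filter-accept (λ x → T? (x ≤ᵇ k)) {xs = w} (≤⇒≤ᵇ a≤k)

restrict-∷-> : ∀ {k a} w → k < a → restrict k (a ∷ w) ≡ restrict k w
restrict-∷-> {k} {a} w k<a =
  filter-reject (λ x → T? (x ≤ᵇ k)) {x = a} {xs = w} (<⇒≱ k<a ∘ ≤ᵇ⇒≤ a k)

restrict-id : ∀ {k w} → All (_≤ k) w → restrict k w ≡ w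
restrict-id {k} w≤k = filter-all (λ x → T? (x ≤ᵇ k)) (All.map ≤⇒≤ᵇ w≤k)

restrict-≤ : ∀ k w → All (_≤ k) (restrict k w)
restrict-≤ k w = All.map (≤ᵇ⇒≤ _ k) (all-filter (λ x → T? (x ≤ᵇ k)) w)

restrict-restrict : ∀ {k n} w → k ≤ n → restrict k (restrict n w) ≡ restrict k w
restrict-restrict []      _ = refl
restrict-restrict {k} {n} (a ∷ w) k≤n with a ≤? n | a ≤? k
... | yes a≤n | yes a≤k
  rewrite restrict-∷-≤ w a≤n | restrict-∷-≤ (restrict n w) a≤k | restrict-∷-≤ w a≤k =
  cong (a ∷_) (restrict-restrict w k≤n)
... | yes a≤n | no a≰k
  rewrite restrict-∷-≤ w a≤n | restrict-∷-> (restrict n w) (≰⇒> a≰k) | restrict-∷-> w (≰⇒> a≰k) =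
  restrict-restrict w k≤n
... | no a≰n | _
  rewrite restrict-∷-> w (≰⇒> a≰n) | restrict-∷-> w (≤-<-trans k≤n (≰⇒> a≰n)) =
  restrict-restrict w k≤n

NoDoubleDescent : List ℕ → Set
NoDoubleDescent w = hasDoubleDescent w ≡ false

record IsSimsun (n : ℕ) (π : List ℕ) : Set where
  field
    length≡         : length π ≡ n
    bounded         : All (λ x → 1 ≤ x × x ≤ n) π
    unique          : Unique π
    noDoubleDescent : ∀ k → 1 ≤ k → k ≤ n → NoDoubleDescent (restrict k π)

T-elem⇒∈ : ∀ {x ys} → Bool.T (elem x ys) → x ∈ ys
T-elem⇒∈ {x} {ys} t = Any.map (≡ᵇ⇒≡ x _) (any⁻ (x ≡ᵇ_) ys t)

∈⇒T-elem : ∀ {x ys} → x ∈ ys → Bool.T (elem x ys)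
∈⇒T-elem {x} x∈ = any⁺ (x ≡ᵇ_) (Any.map (≡⇒≡ᵇ x _) x∈)

distinct⇒Unique : ∀ xs → Bool.T (distinct xs) → Unique xs
distinct⇒Unique []       _ = []
distinct⇒Unique (x ∷ xs) t with Equivalence.to T-∧ t
... | x∉ , t′ = ¬Any⇒All¬ xs (T-not⇒¬T x∉ ∘ ∈⇒T-elem) ∷ distinct⇒Unique xs t′

Unique⇒distinct : ∀ {xs} → Unique xs → Bool.T (distinct xs)
Unique⇒distinct []       = _
Unique⇒distinct (x∉ ∷ u) =
  Equivalence.from T-∧ (¬T⇒T-not (All¬⇒¬Any x∉ ∘ T-elem⇒∈) , Unique⇒distinct u)

∈range⁻ : ∀ {n k} → k ∈ range n → 1 ≤ k × k ≤ n
∈range⁻ k∈ with ∈-map⁻ suc k∈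
... | j , j∈ , refl = s≤s z≤n , ∈-upTo⁻ j∈

∈range⁺ : ∀ {n k} → 1 ≤ k × k ≤ n → k ∈ range n
∈range⁺ {k = suc j} (_ , k≤n) = ∈-map⁺ suc (∈-upTo⁺ k≤n)

range-unique : ∀ n → Unique (range n)
range-unique n = Unique.map⁺ suc-injective (Unique.upTo⁺ n)

∈words⁻ : ∀ as m {v} → v ∈ words as m → length v ≡ m × All (_∈ as) v
∈words⁻ as zero    (here refl) = refl , []
∈words⁻ as (suc m) v∈ with find (∈-concatMap⁻ (λ a → map (a ∷_) (words as m)) {xs = as} v∈)
... | a , a∈ , v∈′ with ∈-map⁻ (a ∷_) v∈′
...   | w , w∈ , refl with ∈words⁻ as m w∈
...     | len , w⊆ = cong suc len , a∈ ∷ w⊆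

∈words⁺ : ∀ as m {v} → length v ≡ m → All (_∈ as) v → v ∈ words as m
∈words⁺ as zero    {[]}    refl []         = here refl
∈words⁺ as (suc m) {a ∷ w} len  (a∈ ∷ w⊆) =
  ∈-concatMap⁺ (λ a → map (a ∷_) (words as m))
               (lose a∈ (∈-map⁺ (a ∷_) (∈words⁺ as m (suc-injective len) w⊆)))

words-unique : ∀ as m → Unique as → Unique (words as m)
words-unique as zero    _ = [] ∷ []
words-unique as (suc m) u =
  Unique-concatMap (λ a → map (a ∷_) (words as m)) u (λ _ → Unique.map⁺ ∷-injectiveʳ (words-unique as m u))
                   (λ _ _ v∈ v∈′ → heads (∈-map⁻ _ v∈) (∈-map⁻ _ v∈′))
  where
  heads : ∀ {x y v} → ∃ (λ w → w ∈ words as m × v ≡ x ∷ w) → ∃ (λ w → w ∈ words as m × v ≡ y ∷ w) →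
    x ≡ y
  heads (_ , _ , v≡xw) (_ , _ , v≡yw′) = ∷-injectiveˡ (trans (sym v≡xw) v≡yw′)

simsun-unique : ∀ n → Unique (simsun n)
simsun-unique n = Unique.filter⁺ _ (Unique.filter⁺ _ (words-unique (range n) n (range-unique n)))

∈simsun⇒IsSimsun : ∀ n {π} → π ∈ simsun n → IsSimsun n π
∈simsun⇒IsSimsun n π∈ with ∈-filter⁻ (T? ∘ isSimsun n) π∈
... | π∈perms , simsun? with ∈-filter⁻ (T? ∘ distinct) π∈perms
...   | π∈words , distinct? with ∈words⁻ (range n) n π∈words
...     | len , π⊆ = record
  { length≡         = len
  ; bounded         = All.map ∈range⁻ π⊆
  ; unique          = distinct⇒Unique _ distinct?
  ; noDoubleDescent = λ k 1≤k k≤n →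
      Equivalence.to T-not-≡ (All.lookup (all⁺ _ (range n) simsun?) (∈range⁺ (1≤k , k≤n)))
  }

IsSimsun⇒∈simsun : ∀ n {π} → IsSimsun n π → π ∈ simsun n
IsSimsun⇒∈simsun n {π} s =
  ∈-filter⁺ (T? ∘ isSimsun n)
    (∈-filter⁺ (T? ∘ distinct) (∈words⁺ (range n) n length≡ (All.map ∈range⁺ bounded))
               (Unique⇒distinct unique))
    (all⁻ _ (All.tabulate λ k∈ → let 1≤k , k≤n = ∈range⁻ k∈ in
                                  Equivalence.from T-not-≡ (noDoubleDescent _ 1≤k k≤n)))
  where open IsSimsun s

noDoubleDescent-tail : ∀ a v → NoDoubleDescent (a ∷ v) → NoDoubleDescent v
noDoubleDescent-tail a []          _  = refl
noDoubleDescent-tail a (_ ∷ [])    _  = refl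
noDoubleDescent-tail a (b ∷ c ∷ v) nd = ∨-conicalʳ ((b <ᵇ a) ∧ (c <ᵇ b)) _ nd

IsSimsun-noDoubleDescent : ∀ {n π} → IsSimsun n π → NoDoubleDescent π
IsSimsun-noDoubleDescent {zero}  {[]}    _ = refl
IsSimsun-noDoubleDescent {zero}  {_ ∷ _} s with IsSimsun.length≡ s
... | ()
IsSimsun-noDoubleDescent {suc n} {π}     s =
  subst NoDoubleDescent (restrict-id (All.map proj₂ bounded)) (noDoubleDescent (suc n) (s≤s z≤n) ≤-refl)
  where open IsSimsun s

IsSimsun-noConsecutiveTrues : ∀ {n π} → IsSimsun n π → NoConsecutiveTrues (descentWord π)
IsSimsun-noConsecutiveTrues {π = π} s =
  trans (sym (hasDoubleDescent-descentWord π)) (IsSimsun-noDoubleDescent s)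

IsSimsun-max∉ : ∀ {n π} → IsSimsun n π → suc n ∉ π
IsSimsun-max∉ s max∈ = 1+n≰n (proj₂ (All.lookup (IsSimsun.bounded s) max∈))

-- Simsun permutations of [n + 1] from those of [n]

data Ins (x : ℕ) : List ℕ → List ℕ → Set where
  lead  : ∀ {w} → canLead w ≡ true → Ins x w (x ∷ w)
  later : ∀ {c w v} → Ins x w v → Ins x (c ∷ w) (c ∷ v)

∈leadIns⁻ : ∀ x w {v} → v ∈ leadIns x w → canLead w ≡ true × v ≡ x ∷ w
∈leadIns⁻ x w v∈ with canLead w in canLead≡
∈leadIns⁻ x w (here v≡) | true = refl , v≡

∈ins⇒Ins : ∀ x w {v} → v ∈ ins x w → Ins x w v
∈ins⇒Ins x []      (here refl) = lead refl
∈ins⇒Ins x (b ∷ w) v∈ with ∈-++⁻ (leadIns x (b ∷ w)) v∈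
... | inj₁ v∈lead with ∈leadIns⁻ x (b ∷ w) v∈lead
...   | canLead≡ , refl = lead canLead≡
∈ins⇒Ins x (b ∷ w) v∈ | inj₂ v∈later with ∈-map⁻ (b ∷_) v∈later
...   | v′ , v′∈ , refl = later (∈ins⇒Ins x w v′∈)

Ins⇒∈ins : ∀ {x w v} → Ins x w v → v ∈ ins x w
Ins⇒∈ins (lead {[]} _) = here refl
Ins⇒∈ins {x} (lead {b ∷ w} canLead≡) = ∈-++⁺ˡ (x∷w∈leadIns canLead≡)
  where
  x∷w∈leadIns : canLead (b ∷ w) ≡ true → (x ∷ b ∷ w) ∈ leadIns x (b ∷ w)
  x∷w∈leadIns eq rewrite eq = here refl
Ins⇒∈ins {x} (later {c} {w} i) = ∈-++⁺ʳ (leadIns x (c ∷ w)) (∈-map⁺ (c ∷_) (Ins⇒∈ins i))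

Ins-restrict : ∀ {x w v} k → k < x → Ins x w v → restrict k v ≡ restrict k w
Ins-restrict k k<x (lead {w} _) = restrict-∷-> w k<x
Ins-restrict k k<x (later {c} {w} {v} i) with c ≤? k
... | yes c≤k rewrite restrict-∷-≤ v c≤k | restrict-∷-≤ w c≤k = cong (c ∷_) (Ins-restrict k k<x i)
... | no  c≰k rewrite restrict-∷-> v (≰⇒> c≰k) | restrict-∷-> w (≰⇒> c≰k) = Ins-restrict k k<x i

Ins-length : ∀ {x w v} → Ins x w v → length v ≡ suc (length w)
Ins-length (lead _)  = refl
Ins-length (later i) = cong suc (Ins-length i)

Ins-All : ∀ {P : ℕ → Set} {x w v} → P x → All P w → Ins x w v → All P v
Ins-All px pw          (lead _)  = px ∷ pw
Ins-All px (pc ∷ pw) (later i) = pc ∷ Ins-All px pw i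

Ins-∈ : ∀ {x w v y} → Ins x w v → y ∈ v → y ≡ x ⊎ y ∈ w
Ins-∈ (lead _)  (here y≡x)  = inj₁ y≡x
Ins-∈ (lead _)  (there y∈w) = inj₂ y∈w
Ins-∈ (later i) (here y≡c)  = inj₂ (here y≡c)
Ins-∈ (later i) (there y∈v) with Ins-∈ i y∈v
... | inj₁ y≡x  = inj₁ y≡x
... | inj₂ y∈w = inj₂ (there y∈w)

Ins-unique : ∀ {x w v} → x ∉ w → Unique w → Ins x w v → Unique v
Ins-unique x∉w u (lead _) = ¬Any⇒All¬ _ x∉w ∷ u
Ins-unique x∉cw (c∉w ∷ u) (later i) =
  ¬Any⇒All¬ _ (λ c∈v → [ (λ c≡x → x∉cw (here (sym c≡x))) , All¬⇒¬Any c∉w ]′ (Ins-∈ i c∈v))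
  ∷ Ins-unique (x∉cw ∘ there) u i

Ins-noDoubleDescent : ∀ {x c w v} → All (_< x) (c ∷ w) → Unique (c ∷ w) → NoDoubleDescent (c ∷ w) →
  Ins x (c ∷ w) v → NoDoubleDescent v
Ins-noDoubleDescent {x} {c} {w} {v} cw<x u nd i =
  trans (hasDoubleDescent-descentWord v)
        (All.lookup (insertionSlots-noConsecutiveTrues (descentWord (c ∷ w))
                                                       (trans (sym (hasDoubleDescent-descentWord (c ∷ w))) nd))
                    (subst (descentWord v ∈_) (descentWord-ins w cw<x (AllPairs⇒Linked u))
                           (∈-map⁺ descentWord (Ins⇒∈ins i))))

ins-unique : ∀ x w → x ∉ w → Unique (ins x w)
ins-unique x []      _   = [] ∷ []
ins-unique x (b ∷ w) x∉ =
  Unique.++⁺ leadIns-unique (Unique.map⁺ ∷-injectiveʳ (ins-unique x w (x∉ ∘ there))) disjoint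
  where
  leadIns-unique : Unique (leadIns x (b ∷ w))
  leadIns-unique with canLead (b ∷ w)
  ... | true  = [] ∷ []
  ... | false = []
  disjoint : ∀ {v} → ¬ (v ∈ leadIns x (b ∷ w) × v ∈ map (b ∷_) (ins x w))
  disjoint (v∈lead , v∈later) with ∈leadIns⁻ x (b ∷ w) v∈lead | ∈-map⁻ (b ∷_) v∈later
  ... | _ , refl | _ , _ , refl = x∉ (here refl)

canLead-afterMax : ∀ {m} w → All (_< m) w → Unique w → NoDoubleDescent (m ∷ w) → canLead w ≡ true
canLead-afterMax []              _                _              _  = refl
canLead-afterMax (_ ∷ [])        _                _              _  = refl
canLead-afterMax {m} (c ∷ d ∷ w) (c<m ∷ _) ((c≢d ∷ _) ∷ _) nd =
  trans (<ᵇ-flip c≢d) (cong not (subst (λ b → (b ∧ (d <ᵇ c)) ≡ false) (<ᵇ-true c<m) (∨-conicalˡ _ _ nd)))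

All-≤∧≢⇒< : ∀ {n} v → All (_≤ suc n) v → All (suc n ≢_) v → All (_< suc n) v
All-≤∧≢⇒< v v≤ v≢ = All.zipWith (λ (x≤ , n≢x) → ≤∧≢⇒< x≤ (n≢x ∘ sym)) (v≤ , v≢)

Ins-deleteMax : ∀ n v → Unique v → All (_≤ suc n) v → suc n ∈ v → NoDoubleDescent v →
  Ins (suc n) (restrict n v) v
Ins-deleteMax n (a ∷ v) (a∉ ∷ u) (a≤ ∷ v≤) max∈ nd with a ≟ suc n
... | yes refl rewrite restrict-∷-> v (n<1+n n) | restrict-id (All.map m<1+n⇒m≤n (All-≤∧≢⇒< v v≤ a∉)) =
  lead (canLead-afterMax v (All-≤∧≢⇒< v v≤ a∉) u nd)
... | no a≢ with max∈
...   | here a≡     = contradiction (sym a≡) a≢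
...   | there max∈v rewrite restrict-∷-≤ v (m<1+n⇒m≤n (≤∧≢⇒< a≤ a≢)) =
  later (Ins-deleteMax n v u v≤ max∈v (noDoubleDescent-tail a v nd))

length-restrict : ∀ n v → Unique v → All (_≤ suc n) v → suc n ∈ v →
  length v ≡ suc (length (restrict n v))
length-restrict n (a ∷ v) (a∉ ∷ u) (a≤ ∷ v≤) max∈ with a ≟ suc n
... | yes refl rewrite restrict-∷-> v (n<1+n n) | restrict-id (All.map m<1+n⇒m≤n (All-≤∧≢⇒< v v≤ a∉)) = refl
... | no a≢ with max∈
...   | here a≡     = contradiction (sym a≡) a≢
...   | there max∈v rewrite restrict-∷-≤ v (m<1+n⇒m≤n (≤∧≢⇒< a≤ a≢)) =
  cong suc (length-restrict n v u v≤ max∈v)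

bounded-below-max : ∀ {m} v → All (λ x → 1 ≤ x × x ≤ suc m) v → suc m ∉ v → All (λ x → 1 ≤ x × x ≤ m) v
bounded-below-max v v∈ max∉ =
  All.zipWith (λ ((1≤x , _) , x<) → 1≤x , m<1+n⇒m≤n x<)
              (v∈ , All-≤∧≢⇒< v (All.map proj₂ v∈) (¬Any⇒All¬ v max∉))

length-bounded : ∀ m v → Unique v → All (λ x → 1 ≤ x × x ≤ m) v → length v ≤ m
length-bounded zero    []      _ _                = z≤n
length-bounded zero    (a ∷ v) _ ((1≤a , a≤0) ∷ _) = contradiction a≤0 (<⇒≱ 1≤a)
length-bounded (suc m) v u v∈ with suc m ∈? v
... | yes max∈ =
  subst (_≤ suc m) (sym (length-restrict m v u (All.map proj₂ v∈) max∈))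
        (s≤s (length-bounded m (restrict m v) (Unique.filter⁺ _ u)
                             (All.zipWith id (filter⁺ _ (All.map proj₁ v∈) , restrict-≤ m v))))
... | no max∉ = m≤n⇒m≤1+n (length-bounded m v u (bounded-below-max v v∈ max∉))

length≡⇒max∈ : ∀ m v → Unique v → All (λ x → 1 ≤ x × x ≤ suc m) v → length v ≡ suc m → suc m ∈ v
length≡⇒max∈ m v u v∈ len with suc m ∈? v
... | yes max∈ = max∈
... | no  max∉ =
  contradiction (subst (_≤ m) len (length-bounded m v u (bounded-below-max v v∈ max∉))) 1+n≰n

IsSimsun-delete : ∀ n {v} → IsSimsun (suc n) v → IsSimsun n (restrict n v) × Ins (suc n) (restrict n v) v
IsSimsun-delete n {v} s = record
  { length≡         = suc-injective (trans (sym (Ins-length deletion)) length≡)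
  ; bounded         = All.zipWith id (filter⁺ _ (All.map proj₁ bounded) , restrict-≤ n v)
  ; unique          = Unique.filter⁺ _ unique
  ; noDoubleDescent = λ k 1≤k k≤n → subst NoDoubleDescent (sym (restrict-restrict v k≤n))
                                          (noDoubleDescent k 1≤k (m≤n⇒m≤1+n k≤n))
  } , deletion
  where
  open IsSimsun s
  deletion : Ins (suc n) (restrict n v) v
  deletion = Ins-deleteMax n v unique (All.map proj₂ bounded) (length≡⇒max∈ n v unique bounded length≡)
                           (IsSimsun-noDoubleDescent s)

IsSimsun-insert : ∀ n {w v} → IsSimsun n w → Ins (suc n) w v → IsSimsun (suc n) v
IsSimsun-insert n {w} {v} s i = record
  { length≡         = trans (Ins-length i) (cong suc length≡)
  ; bounded         = v-bounded
  ; unique          = Ins-unique (IsSimsun-max∉ s) unique i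
  ; noDoubleDescent = noDoubleDescent′
  }
  where
  open IsSimsun s
  v-bounded : All (λ x → 1 ≤ x × x ≤ suc n) v
  v-bounded = Ins-All (s≤s z≤n , ≤-refl) (All.map (λ (1≤x , x≤n) → 1≤x , m≤n⇒m≤1+n x≤n) bounded) i
  v-noDoubleDescent : ∀ {w} → All (λ x → 1 ≤ x × x ≤ n) w → Unique w → NoDoubleDescent w →
    Ins (suc n) w v → NoDoubleDescent v
  v-noDoubleDescent {[]}    _  _ _  (lead _) = refl
  v-noDoubleDescent {_ ∷ _} w≤ u nd i′       = Ins-noDoubleDescent (All.map (s≤s ∘ proj₂) w≤) u nd i′
  noDoubleDescent′ : ∀ k → 1 ≤ k → k ≤ suc n → NoDoubleDescent (restrict k v)
  noDoubleDescent′ k 1≤k k≤1+n with k ≤? n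
  ... | yes k≤n = subst NoDoubleDescent (sym (Ins-restrict k (s≤s k≤n) i)) (noDoubleDescent k 1≤k k≤n)
  ... | no  k≰n with ≤-antisym k≤1+n (≰⇒> k≰n)
  ...   | refl = subst NoDoubleDescent (sym (restrict-id (All.map proj₂ v-bounded)))
                       (v-noDoubleDescent bounded unique (IsSimsun-noDoubleDescent s) i)

simsun-suc-↭ : ∀ n → simsun (suc n) ↭ concatMap (ins (suc n)) (simsun n)
simsun-suc-↭ n =
  ∼bag⇒↭ (unique∧set⇒bag (simsun-unique (suc n))
                          (Unique-concatMap (ins (suc n)) (simsun-unique n) ins-unique′ sameParent)
                          (mk⇔ deleteMax insertMax))
  where
  ins-unique′ : ∀ {w} → w ∈ simsun n → Unique (ins (suc n) w)
  ins-unique′ w∈ = ins-unique (suc n) _ (IsSimsun-max∉ (∈simsun⇒IsSimsun n w∈))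
  restrict-parent : ∀ {w v} → w ∈ simsun n → v ∈ ins (suc n) w → restrict n v ≡ w
  restrict-parent {w} w∈ v∈ =
    trans (Ins-restrict n ≤-refl (∈ins⇒Ins (suc n) w v∈))
          (restrict-id (All.map proj₂ (IsSimsun.bounded (∈simsun⇒IsSimsun n w∈))))
  sameParent : ∀ {x y v} → x ∈ simsun n → y ∈ simsun n → v ∈ ins (suc n) x → v ∈ ins (suc n) y → x ≡ y
  sameParent x∈ y∈ v∈x v∈y = trans (sym (restrict-parent x∈ v∈x)) (restrict-parent y∈ v∈y)
  deleteMax : ∀ {v} → v ∈ simsun (suc n) → v ∈ concatMap (ins (suc n)) (simsun n)
  deleteMax v∈ with IsSimsun-delete n (∈simsun⇒IsSimsun (suc n) v∈)
  ... | s , i = ∈-concatMap⁺ (ins (suc n)) (lose (IsSimsun⇒∈simsun n s) (Ins⇒∈ins i))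
  insertMax : ∀ {v} → v ∈ concatMap (ins (suc n)) (simsun n) → v ∈ simsun (suc n)
  insertMax v∈ with find (∈-concatMap⁻ (ins (suc n)) {xs = simsun n} v∈)
  ... | w , w∈ , v∈ins =
    IsSimsun⇒∈simsun (suc n) (IsSimsun-insert n (∈simsun⇒IsSimsun n w∈) (∈ins⇒Ins (suc n) w v∈ins))

-- Mirror symmetry of the profile distribution

profileOf : List ℕ → Profile
profileOf π = profile (descentWord π)

-- Interior double ascents of a permutation of [n] with a given profile, determined by
-- doubleAscentCount+descents≡length+ends.
doubleAscentsOf : ℕ → Profile → ℕ
doubleAscentsOf n (D , L , I) = n + ind L + ind I ∸ (2 + 2 * D)

insertionStep : ℕ → (Profile → ℕ) → Profile → ℕ
insertionStep n g s = afterInsertion g (doubleAscentsOf n s) s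

doubleAscentCount≡doubleAscentsOf : ∀ d p → NoConsecutiveTrues (d ∷ p) →
  doubleAscentCount (d ∷ p) ≡ doubleAscentsOf (length (d ∷ p) + 1) (profile (d ∷ p))
doubleAscentCount≡doubleAscentsOf d p nct =
  sym (trans (cong (_∸ (2 + 2 * descentCount (d ∷ p))) (sym (doubleAscentCount+descents≡length+ends d p nct)))
             (m+n∸n≡m (doubleAscentCount (d ∷ p)) (2 + 2 * descentCount (d ∷ p))))

sumBy-ins : ∀ n (g : Profile → ℕ) {w} → 2 ≤ n → w ∈ simsun n →
  sumBy (g ∘ profileOf) (ins (suc n) w) ≡ insertionStep n g (profileOf w)
sumBy-ins n g {w} 2≤n w∈ with ∈simsun⇒IsSimsun n w∈
sumBy-ins n g {[]}    2≤n w∈ | s =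
  contradiction (subst (2 ≤_) (sym (IsSimsun.length≡ s)) 2≤n) λ ()
sumBy-ins n g {_ ∷ []} 2≤n w∈ | s =
  contradiction (subst (2 ≤_) (sym (IsSimsun.length≡ s)) 2≤n) λ { (s≤s ()) }
sumBy-ins n g {c ∷ d ∷ w} 2≤n w∈ | s =
  begin
    sumBy (g ∘ profileOf) (ins (suc n) (c ∷ d ∷ w))
  ≡⟨ sumBy-map (g ∘ profile) descentWord (ins (suc n) (c ∷ d ∷ w)) ⟨
    sumBy (g ∘ profile) (map descentWord (ins (suc n) (c ∷ d ∷ w)))
  ≡⟨ cong (sumBy (g ∘ profile))
          (descentWord-ins (d ∷ w) (All.map (s≤s ∘ proj₂) bounded) (AllPairs⇒Linked unique)) ⟩
    sumBy (g ∘ profile) (insertionSlots (descentWord (c ∷ d ∷ w)))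
  ≡⟨ insertionSlots-sum g (d <ᵇ c) (descentWord (d ∷ w)) nct ⟩
    afterInsertion g (doubleAscentCount (descentWord (c ∷ d ∷ w))) (profileOf (c ∷ d ∷ w))
  ≡⟨ cong (λ a → afterInsertion g a (profileOf (c ∷ d ∷ w)))
          (trans (doubleAscentCount≡doubleAscentsOf (d <ᵇ c) (descentWord (d ∷ w)) nct)
                 (cong (λ m → doubleAscentsOf m (profileOf (c ∷ d ∷ w))) len)) ⟩
    insertionStep n g (profileOf (c ∷ d ∷ w))
  ∎
  where
  open ≡-Reasoning
  open IsSimsun s
  nct = IsSimsun-noConsecutiveTrues s
  len : length (descentWord (c ∷ d ∷ w)) + 1 ≡ n
  len = trans (+-comm _ 1) (trans (cong suc (length-descentWord c (d ∷ w))) length≡)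

sumBy-simsun-suc : ∀ n (g : Profile → ℕ) → 2 ≤ n →
  sumBy (g ∘ profileOf) (simsun (suc n)) ≡ sumBy (insertionStep n g ∘ profileOf) (simsun n)
sumBy-simsun-suc n g 2≤n =
  begin
    sumBy (g ∘ profileOf) (simsun (suc n))
  ≡⟨ sumBy-↭ (g ∘ profileOf) (simsun-suc-↭ n) ⟩
    sumBy (g ∘ profileOf) (concatMap (ins (suc n)) (simsun n))
  ≡⟨ sumBy-concatMap (g ∘ profileOf) (ins (suc n)) (simsun n) ⟩
    sumBy (sumBy (g ∘ profileOf) ∘ ins (suc n)) (simsun n)
  ≡⟨ sumBy-cong (simsun n) (sumBy-ins n g 2≤n) ⟩
    sumBy (insertionStep n g ∘ profileOf) (simsun n)
  ∎
  where open ≡-Reasoning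

insertionStep-mirror : ∀ n g s → insertionStep n (g ∘ mirror) s ≡ insertionStep n g (mirror s)
insertionStep-mirror n g s@(D , L , I) =
  trans (afterInsertion-mirror g (doubleAscentsOf n s) s)
        (cong (λ a → afterInsertion g a (mirror s)) (cong (_∸ (2 + 2 * D)) (rearrange n (ind L) (ind I))))
  where
  rearrange : ∀ a b c → a + b + c ≡ a + c + b
  rearrange = solve-∀

sumBy-simsun-mirror : ∀ n → 1 ≤ n → ∀ (g : Profile → ℕ) →
  sumBy (g ∘ profileOf) (simsun n) ≡ sumBy (g ∘ mirror ∘ profileOf) (simsun n)
sumBy-simsun-mirror 1               _ g = refl
sumBy-simsun-mirror 2               _ g = refl
sumBy-simsun-mirror (suc (suc (suc m))) _ g =
  begin
    sumBy (g ∘ profileOf) (simsun (3 + m))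
  ≡⟨ sumBy-simsun-suc (2 + m) g (s≤s (s≤s z≤n)) ⟩
    sumBy (insertionStep (2 + m) g ∘ profileOf) (simsun (2 + m))
  ≡⟨ sumBy-simsun-mirror (suc (suc m)) (s≤s z≤n) (insertionStep (2 + m) g) ⟩
    sumBy (insertionStep (2 + m) g ∘ mirror ∘ profileOf) (simsun (2 + m))
  ≡⟨ sumBy-cong (simsun (2 + m)) (λ {π} _ → insertionStep-mirror (2 + m) g (profileOf π)) ⟨
    sumBy (insertionStep (2 + m) (g ∘ mirror) ∘ profileOf) (simsun (2 + m))
  ≡⟨ sumBy-simsun-suc (2 + m) (g ∘ mirror) (s≤s (s≤s z≤n)) ⟨
    sumBy (g ∘ mirror ∘ profileOf) (simsun (3 + m))
  ∎
  where open ≡-Reasoning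

uprun-turnCount : ∀ {n π} → 1 ≤ n → IsSimsun n π → uprun π ≡ suc (turnCount (false ∷ descentWord π))
uprun-turnCount {π = []}    1≤n s with IsSimsun.length≡ s
uprun-turnCount {π = []}    () s | refl
uprun-turnCount {π = a ∷ π} 1≤n s with IsSimsun.bounded s
... | (1≤a , _) ∷ _ = cong suc (turns-descentWord (<⇒≢ 1≤a ∷ AllPairs⇒Linked (IsSimsun.unique s)))

uprun-split-des : ∀ {n π} k → 1 ≤ n → IsSimsun n π →
  ind (uprun π ≡ᵇ 2 * k) + ind (uprun π ≡ᵇ 2 * k + 1) ≡ ind (des π ≡ᵇ k)
uprun-split-des {π = π} k 1≤n s =
  trans (halving-split (descentCount p) k (not (finalDescent p))
                       (trans (uprun-turnCount 1≤n s)
                              (suc-from-parity _ (finalDescent p) (descentCount p)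
                                               (turnCount-false∷ p (IsSimsun-noConsecutiveTrues s)))))
        (cong (λ d → ind (d ≡ᵇ k)) (sym (des-descentWord π)))
  where
  p = descentWord π

trimmedDescents : Profile → ℕ
trimmedDescents (D , _ , I) = D ∸ ind I

pk≡trimmedDescents : ∀ {n π} → IsSimsun n π → pk π ≡ trimmedDescents (profileOf π)
pk≡trimmedDescents {π = π} s =
  trans (pk-descentWord (AllPairs⇒Linked (IsSimsun.unique s)))
        (sym (trans (cong (_∸ ind (initialDescent p))
                          (sym (peakCount+initial≡descentCount p (IsSimsun-noConsecutiveTrues s))))
                    (m+n∸n≡m (peakCount p) (ind (initialDescent p)))))
  where
  p = descentWord π

uprun-split-trimmed : ∀ {n π} k → 1 ≤ n → IsSimsun n π →
  ind (uprun π ≡ᵇ 2 * k + 1) + ind (uprun π ≡ᵇ 2 * k + 2) ≡ ind (trimmedDescents (mirror (profileOf π)) ≡ᵇ k)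
uprun-split-trimmed {π = π} k 1≤n s rewrite uprun-turnCount 1≤n s =
  halving-split-suc (descentCount p ∸ ind (finalDescent p)) k (finalDescent p)
                    (from-parity _ (finalDescent p) (descentCount p)
                                 (turnCount-false∷ p (IsSimsun-noConsecutiveTrues s)))
  where
  p = descentWord π

mainTheorem8 : (n : ℕ) → n ≥ 1 → (k : ℕ) →
    (S n k ≡ T n (2 * k) + T n (2 * k + 1)) ×
    (P n k ≡ T n (2 * k + 1) + T n (2 * k + 2))
mainTheorem8 n 1≤n k =
  trans (count≡sumBy _ (simsun n))
        (sym (count+count≡sumBy _ _ _ (simsun n) (uprun-split-des k 1≤n ∘ ∈simsun⇒IsSimsun n))) ,
  (begin
     P n k
   ≡⟨ count≡sumBy _ (simsun n) ⟩
     sumBy (λ π → ind (pk π ≡ᵇ k)) (simsun n)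
   ≡⟨ sumBy-cong (simsun n) (cong (λ m → ind (m ≡ᵇ k)) ∘ pk≡trimmedDescents ∘ ∈simsun⇒IsSimsun n) ⟩
     sumBy (trimmed≡k ∘ profileOf) (simsun n)
   ≡⟨ sumBy-simsun-mirror n 1≤n trimmed≡k ⟩
     sumBy (trimmed≡k ∘ mirror ∘ profileOf) (simsun n)
   ≡⟨ count+count≡sumBy _ _ _ (simsun n) (uprun-split-trimmed k 1≤n ∘ ∈simsun⇒IsSimsun n) ⟨
     T n (2 * k + 1) + T n (2 * k + 2)
   ∎)
  where
  open ≡-Reasoning
  trimmed≡k : Profile → ℕ
  trimmed≡k s = ind (trimmedDescents s ≡ᵇ k)
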